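{- Consider the base model and suppose $q_j=0$ for all $j\in\mathbf M$. Let $\pi^p$ be the optimal value of $\max\{\pi(x,y): x\in\{0,1\}^n, y\in\{0,1\}^m\}$ for this instance. Then the assortment $(x,y)$ defined by $x_i=1$ if and only if $p_i\ge \pi^p$ (for $i\in\mathbf N$), and $y_j=1$ if and only if $$\frac{\sum_{i\in\mathbf N}u_{ij}p_ix_i}{\sum_{i\in\mathbf N_+}u_{ij}x_i}\ge \pi^p \quad (j\in\mathbf M,\ \text{with } x_0=1),$$ is an optimal solution of this problem.
   Context: Base model. Let $n,m$ be positive integers, $\mathbf N=\{1,\dots,n\}$, $\mathbf M=\{1,\dots,m\}$, $\mathbf N_+=\mathbf N\cup\{0\}$, $\mathbf M_+=\mathbf M\cup\{0\}$. Prices $p_i\ge 0$ ($i\in\mathbf N$), $q_j\ge 0$ ($j\in\mathbf M$), $p_0=q_0=0$. Preference weights $u_{ij}\ge 0$ for $(i,j)\in\mathbf N_+\times\mathbf M_+$, with $u_{00}=1$. For an assortment $(x,y)\in\{0,1\}^n\times\{0,1\}^m$, set $x_0=y_0=1$ and $$\pi(x,y)=\frac{\sum_{i\in\mathbf N_+,j\in\mathbf M_+}u_{ij}x_iy_j(p_i+q_j)}{\sum_{i\in\mathbf N_+,j\in\mathbf M_+}u_{ij}x_iy_j}.$$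
   Formalization: The prices $p_i$, $q_j$ and the preference weights $u_{ij}$ take values in the nonnegative rationals rather than the nonnegative reals. -}

module Defs where

open import Data.Bool using (Bool; true; false)
open import Data.Fin using (Fin; zero; suc)
open import Data.Nat using (ℕ)
open import Data.Rational using (ℚ; 0ℚ; 1ℚ; _+_; _*_; _÷_; _≤_; ≢-nonZero)
open import Data.Rational.Properties using (_≟_; _≤?_)
open import Relation.Nullary using (yes; no; does)

Σ[_] : (k : ℕ) → (Fin k → ℚ) → ℚ
Σ[ ℕ.zero ] f = 0ℚ
Σ[ ℕ.suc k ] f = f zero + Σ[ k ] (λ i → f (suc i))

ind : Bool → ℚ
ind true = 1ℚ
ind false = 0ℚ

-- division, with the (irrelevant for π, whose denominator is ≥ u₀₀ = 1) convention a/0 = 0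
_÷?_ : ℚ → ℚ → ℚ
a ÷? b with b ≟ 0ℚ
... | yes _ = 0ℚ
... | no b≢0 = _÷_ a b {{≢-nonZero b≢0}}

-- extend a vector indexed by N (resp. M) to N₊ = Fin (suc n), index 0 getting the value d
ext : {A : Set} {k : ℕ} → A → (Fin k → A) → Fin (ℕ.suc k) → A
ext d f zero = d
ext d f (suc i) = f i

-- π(x,y) for the base model: u indexed by N₊ × M₊, p by N, q by M, p₀ = q₀ = 0, x₀ = y₀ = 1
π : {n m : ℕ} → (Fin n → ℚ) → (Fin m → ℚ) → (Fin (ℕ.suc n) → Fin (ℕ.suc m) → ℚ)
  → (Fin n → Bool) → (Fin m → Bool) → ℚ
π {n} {m} p q u x y =
  (Σ[ ℕ.suc n ] λ i → Σ[ ℕ.suc m ] λ j →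
     u i j * ind (ext true x i) * ind (ext true y j) * (ext 0ℚ p i + ext 0ℚ q j))
  ÷?
  (Σ[ ℕ.suc n ] λ i → Σ[ ℕ.suc m ] λ j →
     u i j * ind (ext true x i) * ind (ext true y j))

IsOptimalValue : {n m : ℕ} → (Fin n → ℚ) → (Fin m → ℚ) → (Fin (ℕ.suc n) → Fin (ℕ.suc m) → ℚ) → ℚ → Set
IsOptimalValue {n} {m} p q u v =
  (Σ' (Fin n → Bool) λ x → Σ' (Fin m → Bool) λ y → π p q u x y ≡ v)
  ×' ((x : Fin n → Bool) (y : Fin m → Bool) → π p q u x y ≤ v)
  where
    open import Data.Product renaming (Σ to Σ'; _×_ to _×'_)
    open import Relation.Binary.PropositionalEquality using (_≡_)

xStar : {n : ℕ} → (Fin n → ℚ) → ℚ → Fin n → Bool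
xStar p v i = does (v ≤? p i)

yStar : {n m : ℕ} → (Fin n → ℚ) → (Fin (ℕ.suc n) → Fin (ℕ.suc m) → ℚ) → ℚ → Fin m → Bool
yStar {n} p u v j =
  does (v ≤? ((Σ[ n ] λ i → u (suc i) (suc j) * ext 0ℚ p (suc i) * ind (xStar p v i))
              ÷? (Σ[ ℕ.suc n ] λ i → u i (suc j) * ind (ext true (xStar p v) i))))

-- Dinkelbach's parametrisation: since the denominator D of π is at least u₀₀ = 1, c ≤ π(x,y) iff
-- the excess E_c(x,y) = Σ u_ij x_i y_j (p_i + q_j - c) = N - c D is nonnegative. With q = 0 every
-- term is u_ij x_i y_j (p_i - c), so for fixed y the excess is maximised termwise by x_i = [p_i ≥ c],
-- and for fixed x it splits into columns y_j (R_j - c W_j), each maximised by y_j = [R_j / W_j ≥ c].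
-- At an optimal assortment E_c = 0 for c = π^p; the two improvements keep E_c ≥ 0 at (x*, y*).
module Submission where

open import Defs
open import Data.Bool using (Bool; true; false)
open import Data.Fin using (Fin; zero; suc)
open import Data.Nat using (ℕ; zero; suc)
open import Data.Product using (_,_)
open import Data.Rational using (ℚ; 0ℚ; 1ℚ; _≤_; _<_; _+_; _*_; _-_; -_; 1/_;
  nonNegative; nonPositive; positive; ≢-nonZero)
open import Data.Rational.Properties
open import Data.Rational.Solver using (module +-*-Solver)
open import Function using (_∘_; _⇔_; mk⇔; Equivalence)
open import Relation.Binary.PropositionalEquality
  using (_≡_; _≢_; ≢-sym; refl; sym; trans; cong; cong₂; subst; subst₂; module ≡-Reasoning)
open import Relation.Nullary using (Dec; yes; no; does; ¬_)
open import Relation.Nullary.Negation using (contradiction)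

open +-*-Solver
open Equivalence using (to; from)

variable
  a b c : ℚ

p≤q⇒0≤q-p : a ≤ b → 0ℚ ≤ b - a
p≤q⇒0≤q-p {a} {b} a≤b = subst (_≤ b - a) (+-inverseʳ a) (+-monoˡ-≤ (- a) a≤b)

0≤q-p⇒p≤q : 0ℚ ≤ b - a → a ≤ b
0≤q-p⇒p≤q {b} {a} 0≤b-a = subst₂ _≤_ (+-identityˡ a) b-a+a≡b (+-monoˡ-≤ a 0≤b-a)
  where
  b-a+a≡b : b - a + a ≡ b
  b-a+a≡b = trans (+-assoc b (- a) a) (trans (cong (b +_) (+-inverseˡ a)) (+-identityʳ b))

p≤q⇒p-q≤0 : a ≤ b → a - b ≤ 0ℚ
p≤q⇒p-q≤0 {a} {b} a≤b = subst (a - b ≤_) (+-inverseʳ b) (+-monoˡ-≤ (- b) a≤b)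

p≤p+q : 0ℚ ≤ b → a ≤ a + b
p≤p+q {b} {a} 0≤b = subst (_≤ a + b) (+-identityʳ a) (+-monoʳ-≤ a 0≤b)

p≤q+p : 0ℚ ≤ b → a ≤ b + a
p≤q+p {b} {a} 0≤b = subst (_≤ b + a) (+-identityˡ a) (+-monoˡ-≤ a 0≤b)

*-nonNeg : 0ℚ ≤ a → 0ℚ ≤ b → 0ℚ ≤ a * b
*-nonNeg {a} {b} 0≤a 0≤b =
  nonNegative⁻¹ _ {{nonNeg*nonNeg⇒nonNeg a {{nonNegative 0≤a}} b {{nonNegative 0≤b}}}}

*-nonNeg-nonPos : 0ℚ ≤ a → b ≤ 0ℚ → a * b ≤ 0ℚ
*-nonNeg-nonPos {a} {b} 0≤a b≤0 =
  nonPositive⁻¹ _ {{nonNeg*nonPos⇒nonPos a {{nonNegative 0≤a}} b {{nonPositive b≤0}}}}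

÷?-*-cancel : b ≢ 0ℚ → (a ÷? b) * b ≡ a
÷?-*-cancel {b} {a} b≢0 with b ≟ 0ℚ
... | yes b≡0 = contradiction b≡0 b≢0
... | no b≢0' = begin
  a * (1/ b) * b  ≡⟨ *-assoc a _ b ⟩
  a * (1/ b * b)  ≡⟨ cong (a *_) (*-inverseˡ b) ⟩
  a * 1ℚ          ≡⟨ *-identityʳ a ⟩
  a               ∎
  where
  open ≡-Reasoning
  instance _ = ≢-nonZero b≢0'

≤÷?⇔0≤-* : 0ℚ < b → (c ≤ a ÷? b) ⇔ (0ℚ ≤ a - c * b)
≤÷?⇔0≤-* {b} {c} {a} 0<b = mk⇔
  (λ c≤a/b → p≤q⇒0≤q-p (subst (c * b ≤_) a/b*b≡a (*-monoʳ-≤-nonNeg b c≤a/b)))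
  (λ 0≤a-cb → *-cancelʳ-≤-pos b (subst (c * b ≤_) (sym a/b*b≡a) (0≤q-p⇒p≤q 0≤a-cb)))
  where
  instance
    _ = positive 0<b
    _ = pos⇒nonNeg b
  a/b*b≡a : (a ÷? b) * b ≡ a
  a/b*b≡a = ÷?-*-cancel (≢-sym (<⇒≢ 0<b))

ind-nonNeg : ∀ β → 0ℚ ≤ ind β
ind-nonNeg true = ≤ᵇ⇒≤ _
ind-nonNeg false = ≤-refl

ind-does-maximises : ∀ {P : Set} (P? : Dec P) β {w} →
                     (P → 0ℚ ≤ w) → (¬ P → w ≤ 0ℚ) → ind β * w ≤ ind (does P?) * w
ind-does-maximises (yes _) true  _   _   = ≤-refl
ind-does-maximises (yes P) false {w} 0≤w _ = subst₂ _≤_ (sym (*-zeroˡ w)) (sym (*-identityˡ w)) (0≤w P)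
ind-does-maximises (no ¬P) true  {w} _ w≤0 = subst₂ _≤_ (sym (*-identityˡ w)) (sym (*-zeroˡ w)) (w≤0 ¬P)
ind-does-maximises (no _)  false _   _   = ≤-refl

ratio-test-maximises : ∀ β → 0ℚ ≤ b → (b ≡ 0ℚ → a - c * b ≡ 0ℚ) →
                       ind β * (a - c * b) ≤ ind (does (c ≤? a ÷? b)) * (a - c * b)
ratio-test-maximises {b} {a} {c} β 0≤b b≡0⇒≡0 = decide (b ≟ 0ℚ)
  where
  decide : Dec (b ≡ 0ℚ) → ind β * (a - c * b) ≤ ind (does (c ≤? a ÷? b)) * (a - c * b)
  -- the test then reads the junk value a ÷? 0 = 0, but a - c * b vanishes
  decide (yes b≡0) = ind-does-maximises (c ≤? a ÷? b) β
    (λ _ → ≤-reflexive (sym (b≡0⇒≡0 b≡0))) (λ _ → ≤-reflexive (b≡0⇒≡0 b≡0))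
  decide (no b≢0) = ind-does-maximises (c ≤? a ÷? b) β
    (to ratio⇔) (λ c≰a/b → <⇒≤ (≰⇒> (c≰a/b ∘ from ratio⇔)))
    where
    ratio⇔ : (c ≤ a ÷? b) ⇔ (0ℚ ≤ a - c * b)
    ratio⇔ = ≤÷?⇔0≤-* (≰⇒> (λ b≤0 → b≢0 (≤-antisym b≤0 0≤b)))

Σ-cong : ∀ k {f g : Fin k → ℚ} → (∀ i → f i ≡ g i) → Σ[ k ] f ≡ Σ[ k ] g
Σ-cong zero    f≡g = refl
Σ-cong (suc k) f≡g = cong₂ _+_ (f≡g zero) (Σ-cong k (f≡g ∘ suc))

Σ-mono : ∀ k {f g : Fin k → ℚ} → (∀ i → f i ≤ g i) → Σ[ k ] f ≤ Σ[ k ] g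
Σ-mono zero    f≤g = ≤-refl
Σ-mono (suc k) f≤g = +-mono-≤ (f≤g zero) (Σ-mono k (f≤g ∘ suc))

Σ-≡0 : ∀ k {f : Fin k → ℚ} → (∀ i → f i ≡ 0ℚ) → Σ[ k ] f ≡ 0ℚ
Σ-≡0 zero    f≡0 = refl
Σ-≡0 (suc k) f≡0 = cong₂ _+_ (f≡0 zero) (Σ-≡0 k (f≡0 ∘ suc))

Σ-nonNeg : ∀ k {f : Fin k → ℚ} → (∀ i → 0ℚ ≤ f i) → 0ℚ ≤ Σ[ k ] f
Σ-nonNeg k {f} 0≤f = subst (_≤ Σ[ k ] f) (Σ-≡0 k (λ _ → refl)) (Σ-mono k 0≤f)

term≤Σ : ∀ k {f : Fin k → ℚ} → (∀ i → 0ℚ ≤ f i) → ∀ i → f i ≤ Σ[ k ] f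
term≤Σ (suc k) 0≤f zero    = p≤p+q (Σ-nonNeg k (0≤f ∘ suc))
term≤Σ (suc k) 0≤f (suc i) = ≤-trans (term≤Σ k (0≤f ∘ suc) i) (p≤q+p (0≤f zero))

Σ-≡0⇒≡0 : ∀ k {f : Fin k → ℚ} → (∀ i → 0ℚ ≤ f i) → Σ[ k ] f ≡ 0ℚ → ∀ i → f i ≡ 0ℚ
Σ-≡0⇒≡0 k {f} 0≤f Σf≡0 i = ≤-antisym (subst (f i ≤_) Σf≡0 (term≤Σ k 0≤f i)) (0≤f i)

Σ-distrib-+ : ∀ k (f g : Fin k → ℚ) → Σ[ k ] (λ i → f i + g i) ≡ Σ[ k ] f + Σ[ k ] g
Σ-distrib-+ zero    f g = refl
Σ-distrib-+ (suc k) f g =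
  trans (cong (f zero + g zero +_) (Σ-distrib-+ k (f ∘ suc) (g ∘ suc)))
        (solve 4 (λ a b c d → a :+ b :+ (c :+ d) := a :+ c :+ (b :+ d)) refl
               (f zero) (g zero) (Σ[ k ] (f ∘ suc)) (Σ[ k ] (g ∘ suc)))

Σ-comm : ∀ k l (f : Fin k → Fin l → ℚ) →
         Σ[ k ] (λ i → Σ[ l ] (f i)) ≡ Σ[ l ] (λ j → Σ[ k ] (λ i → f i j))
Σ-comm zero    l f = sym (Σ-≡0 l (λ _ → refl))
Σ-comm (suc k) l f =
  trans (cong (Σ[ l ] (f zero) +_) (Σ-comm k l (f ∘ suc)))
        (sym (Σ-distrib-+ l (f zero) (λ j → Σ[ k ] (λ i → f (suc i) j))))

*-distribˡ-Σ : ∀ k c (f : Fin k → ℚ) → c * Σ[ k ] f ≡ Σ[ k ] (λ i → c * f i)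
*-distribˡ-Σ zero    c f = *-zeroʳ c
*-distribˡ-Σ (suc k) c f =
  trans (*-distribˡ-+ c (f zero) _) (cong (c * f zero +_) (*-distribˡ-Σ k c (f ∘ suc)))

Σ-linear : ∀ k c (f g : Fin k → ℚ) → Σ[ k ] (λ i → f i - c * g i) ≡ Σ[ k ] f - c * Σ[ k ] g
Σ-linear zero    c f g = solve 1 (λ c → con 0ℚ := con 0ℚ :- c :* con 0ℚ) refl c
Σ-linear (suc k) c f g =
  trans (cong (f zero - c * g zero +_) (Σ-linear k c (f ∘ suc) (g ∘ suc)))
        (solve 5 (λ a b x y c → a :- c :* b :+ (x :- c :* y) := a :+ x :- c :* (b :+ y)) refl
               (f zero) (g zero) (Σ[ k ] (f ∘ suc)) (Σ[ k ] (g ∘ suc)) c)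

module Excess {n m : ℕ} (p : Fin n → ℚ) (q : Fin m → ℚ)
              (u : Fin (suc n) → Fin (suc m) → ℚ) (u≥0 : ∀ i j → 0ℚ ≤ u i j) where

  X : (Fin n → Bool) → Fin (suc n) → ℚ
  X x i = ind (ext true x i)

  Y : (Fin m → Bool) → Fin (suc m) → ℚ
  Y y j = ind (ext true y j)

  P : Fin (suc n) → ℚ
  P = ext 0ℚ p

  numerator denominator : (Fin n → Bool) → (Fin m → Bool) → ℚ
  numerator x y = Σ[ suc n ] λ i → Σ[ suc m ] λ j → u i j * X x i * Y y j * (P i + ext 0ℚ q j)
  denominator x y = Σ[ suc n ] λ i → Σ[ suc m ] λ j → u i j * X x i * Y y j

  -- Dinkelbach's parametric objective N - c D, written with q already set to 0.
  excess : ℚ → (Fin n → Bool) → (Fin m → Bool) → ℚ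
  excess c x y = Σ[ suc n ] λ i → Σ[ suc m ] λ j → Y y j * (X x i * (u i j * (P i - c)))

  excess≡numerator-c*denominator : (∀ j → q j ≡ 0ℚ) → ∀ c x y →
                                   excess c x y ≡ numerator x y - c * denominator x y
  excess≡numerator-c*denominator q≡0 c x y = begin
    excess c x y
      ≡⟨ Σ-cong (suc n) (λ i → Σ-cong (suc m) (term i)) ⟩
    (Σ[ suc n ] λ i → Σ[ suc m ] λ j → w i j * r i j - c * w i j)
      ≡⟨ Σ-cong (suc n) (λ i → Σ-linear (suc m) c (λ j → w i j * r i j) (w i)) ⟩
    (Σ[ suc n ] λ i → Σ[ suc m ] (λ j → w i j * r i j) - c * Σ[ suc m ] (w i))
      ≡⟨ Σ-linear (suc n) c (λ i → Σ[ suc m ] λ j → w i j * r i j) (λ i → Σ[ suc m ] (w i)) ⟩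
    numerator x y - c * denominator x y
      ∎
    where
    open ≡-Reasoning
    w : Fin (suc n) → Fin (suc m) → ℚ
    w i j = u i j * X x i * Y y j
    r : Fin (suc n) → Fin (suc m) → ℚ
    r i j = P i + ext 0ℚ q j
    Q≡0 : ∀ j → ext 0ℚ q j ≡ 0ℚ
    Q≡0 zero    = refl
    Q≡0 (suc j) = q≡0 j
    term : ∀ i j → Y y j * (X x i * (u i j * (P i - c))) ≡ w i j * r i j - c * w i j
    term i j rewrite Q≡0 j =
      solve 5 (λ y x v e c → y :* (x :* (v :* (e :- c)))
                             := v :* x :* y :* (e :+ con 0ℚ) :- c :* (v :* x :* y))
            refl (Y y j) (X x i) (u i j) (P i) c

  weight-nonNeg : ∀ x y i j → 0ℚ ≤ u i j * X x i * Y y j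
  weight-nonNeg x y i j =
    *-nonNeg (*-nonNeg (u≥0 i j) (ind-nonNeg (ext true x i))) (ind-nonNeg (ext true y j))

  denominator-pos : u zero zero ≡ 1ℚ → ∀ x y → 0ℚ < denominator x y
  denominator-pos u₀₀≡1 x y = <-≤-trans (positive⁻¹ 1ℚ) (begin
    1ℚ
      ≡⟨ cong (λ t → t * 1ℚ * 1ℚ) u₀₀≡1 ⟨
    u zero zero * 1ℚ * 1ℚ
      ≤⟨ term≤Σ (suc m) (weight-nonNeg x y zero) zero ⟩
    Σ[ suc m ] (λ j → u zero j * 1ℚ * Y y j)
      ≤⟨ term≤Σ (suc n) (λ i → Σ-nonNeg (suc m) (weight-nonNeg x y i)) zero ⟩
    denominator x y
      ∎)
    where open ≤-Reasoning

  ≤π⇔0≤excess : (∀ j → q j ≡ 0ℚ) → u zero zero ≡ 1ℚ → ∀ c x y →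
                (c ≤ π p q u x y) ⇔ (0ℚ ≤ excess c x y)
  ≤π⇔0≤excess q≡0 u₀₀≡1 c x y =
    subst (λ e → (c ≤ π p q u x y) ⇔ (0ℚ ≤ e)) (sym (excess≡numerator-c*denominator q≡0 c x y))
          (≤÷?⇔0≤-* (denominator-pos u₀₀≡1 x y))

  excess-≤-xStar : ∀ c x y → excess c x y ≤ excess c (xStar p c) y
  excess-≤-xStar c x y = Σ-mono (suc n) λ i → Σ-mono (suc m) λ j →
    *-monoˡ-≤-nonNeg (Y y j) {{nonNegative (ind-nonNeg (ext true y j))}} (choose i j)
    where
    choose : ∀ i j → X x i * (u i j * (P i - c)) ≤ X (xStar p c) i * (u i j * (P i - c))
    choose zero    j = ≤-refl
    choose (suc i) j = ind-does-maximises (c ≤? p i) (x i)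
      (λ c≤pᵢ → *-nonNeg (u≥0 _ _) (p≤q⇒0≤q-p c≤pᵢ))
      (λ c≰pᵢ → *-nonNeg-nonPos (u≥0 _ _) (p≤q⇒p-q≤0 (<⇒≤ (≰⇒> c≰pᵢ))))

  columnExcess : ℚ → (Fin n → Bool) → Fin (suc m) → ℚ
  columnExcess c x j = Σ[ suc n ] λ i → X x i * (u i j * (P i - c))

  excess≡ΣcolumnExcess : ∀ c x y → excess c x y ≡ Σ[ suc m ] λ j → Y y j * columnExcess c x j
  excess≡ΣcolumnExcess c x y =
    trans (Σ-comm (suc n) (suc m) (λ i j → Y y j * g i j))
          (Σ-cong (suc m) λ j → sym (*-distribˡ-Σ (suc n) (Y y j) (λ i → g i j)))
    where
    g : Fin (suc n) → Fin (suc m) → ℚ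
    g i j = X x i * (u i j * (P i - c))

  columnRevenue columnWeight : (Fin n → Bool) → Fin m → ℚ
  columnRevenue x j = Σ[ n ] λ i → u (suc i) (suc j) * P (suc i) * ind (x i)
  columnWeight  x j = Σ[ suc n ] λ i → u i (suc j) * X x i

  -- yStar p u c unfolds to bestY c (xStar p c)
  bestY : ℚ → (Fin n → Bool) → Fin m → Bool
  bestY c x j = does (c ≤? columnRevenue x j ÷? columnWeight x j)

  columnExcess≡revenue-c*weight : ∀ c x j →
    columnExcess c x (suc j) ≡ columnRevenue x j - c * columnWeight x j
  columnExcess≡revenue-c*weight c x j = begin
    columnExcess c x (suc j)
      ≡⟨ Σ-cong (suc n) (λ i → rearrange (X x i) (u i (suc j)) (P i)) ⟩
    Σ[ suc n ] (λ i → u i (suc j) * P i * X x i - c * (u i (suc j) * X x i))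
      ≡⟨ Σ-linear (suc n) c (λ i → u i (suc j) * P i * X x i) (λ i → u i (suc j) * X x i) ⟩
    u zero (suc j) * 0ℚ * 1ℚ + columnRevenue x j - c * columnWeight x j
      ≡⟨ cong (λ t → t * 1ℚ + columnRevenue x j - c * columnWeight x j) (*-zeroʳ (u zero (suc j))) ⟩
    0ℚ + columnRevenue x j - c * columnWeight x j
      ≡⟨ cong (_- c * columnWeight x j) (+-identityˡ (columnRevenue x j)) ⟩
    columnRevenue x j - c * columnWeight x j
      ∎
    where
    open ≡-Reasoning
    rearrange : ∀ x w e → x * (w * (e - c)) ≡ w * e * x - c * (w * x)
    rearrange x w e =
      solve 4 (λ x w e c → x :* (w :* (e :- c)) := w :* e :* x :- c :* (w :* x)) refl x w e c

  columnWeight-terms-nonNeg : ∀ x j i → 0ℚ ≤ u i (suc j) * X x i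
  columnWeight-terms-nonNeg x j i = *-nonNeg (u≥0 i (suc j)) (ind-nonNeg (ext true x i))

  columnExcess≡0 : ∀ c x j → columnWeight x j ≡ 0ℚ → columnExcess c x (suc j) ≡ 0ℚ
  columnExcess≡0 c x j W≡0 = Σ-≡0 (suc n) λ i → begin
    X x i * (u i (suc j) * (P i - c))
      ≡⟨ solve 4 (λ x w e c → x :* (w :* (e :- c)) := w :* x :* (e :- c)) refl (X x i) (u i (suc j)) (P i) c ⟩
    u i (suc j) * X x i * (P i - c)
      ≡⟨ cong (_* (P i - c)) (Σ-≡0⇒≡0 (suc n) (columnWeight-terms-nonNeg x j) W≡0 i) ⟩
    0ℚ * (P i - c)
      ≡⟨ *-zeroˡ (P i - c) ⟩
    0ℚ
      ∎
    where open ≡-Reasoning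

  bestY-maximises-columnExcess : ∀ c x β j →
    ind β * columnExcess c x (suc j) ≤ ind (bestY c x j) * columnExcess c x (suc j)
  bestY-maximises-columnExcess c x β j =
    subst (λ G → ind β * G ≤ ind (bestY c x j) * G) (sym G≡)
          (ratio-test-maximises {b = W} {a = R} {c = c} β (Σ-nonNeg (suc n) (columnWeight-terms-nonNeg x j))
                                (λ W≡0 → trans (sym G≡) (columnExcess≡0 c x j W≡0)))
    where
    R W : ℚ
    R = columnRevenue x j
    W = columnWeight x j
    G≡ : columnExcess c x (suc j) ≡ R - c * W
    G≡ = columnExcess≡revenue-c*weight c x j

  excess-≤-bestY : ∀ c x y → excess c x y ≤ excess c x (bestY c x)
  excess-≤-bestY c x y =
    subst₂ _≤_ (sym (excess≡ΣcolumnExcess c x y)) (sym (excess≡ΣcolumnExcess c x (bestY c x)))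
               (Σ-mono (suc m) choose)
    where
    choose : ∀ j → Y y j * columnExcess c x j ≤ Y (bestY c x) j * columnExcess c x j
    choose zero    = ≤-refl
    choose (suc j) = bestY-maximises-columnExcess c x (y j) j

lemma1 : (n m : ℕ) (p : Fin n → ℚ) (q : Fin m → ℚ)
         (u : Fin (ℕ.suc n) → Fin (ℕ.suc m) → ℚ) →
         (∀ i → 0ℚ ≤ p i) → (∀ j → 0ℚ ≤ q j) →
         (∀ i j → 0ℚ ≤ u i j) → u zero zero ≡ 1ℚ →
         (∀ j → q j ≡ 0ℚ) →
         (πp : ℚ) → IsOptimalValue p q u πp →
         (x : Fin n → Bool) (y : Fin m → Bool) →
         π p q u x y ≤ π p q u (xStar p πp) (yStar p u πp)
lemma1 n m p q u _ _ u≥0 u₀₀≡1 q≡0 πp ((x̂ , ŷ , π̂≡πp) , πp-max) x y =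
  ≤-trans (πp-max x y) (from (≤π⇔0≤excess q≡0 u₀₀≡1 πp x* y*) (begin
    0ℚ               ≤⟨ to (≤π⇔0≤excess q≡0 u₀₀≡1 πp x̂ ŷ) (≤-reflexive (sym π̂≡πp)) ⟩
    excess πp x̂ ŷ   ≤⟨ excess-≤-xStar πp x̂ ŷ ⟩
    excess πp x* ŷ   ≤⟨ excess-≤-bestY πp x* ŷ ⟩
    excess πp x* y*  ∎))
  where
  open Excess p q u u≥0
  open ≤-Reasoning
  x* : Fin n → Bool
  x* = xStar p πp
  y* : Fin m → Bool
  y* = yStar p u πp
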